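{- Let $X$ be a topological space satisfying ${\sf S}_1(\Omega_X,\Omega_X)$, let $A\in\Omega_X$ be countable with a fixed bijective enumeration $(a_n:n\in\mathbb{N})$, and let $R\subseteq[A]^{\aleph_0}\cap\Omega_X$. Let $t\subseteq A$ be finite and let $B\in[A]^{\aleph_0}\cap\Omega_X$ be such that for each finite $s\subseteq t\cup B$, $B|s$ accepts $s$ or $B|s$ rejects $s$. If $B|t$ rejects $t$, then $C=\{u\in B: B|(t\cup\{u\})\text{ rejects } t\cup\{u\}\}$ is a member of $\Omega_X$.
   Context: An $\omega$-cover of $X$ is an open cover $\mathcal{U}$ with $X\notin\mathcal{U}$ such that each finite subset of $X$ lies in some member of $\mathcal{U}$; $\Omega_X$ is the set of $\omega$-covers. ${\sf S}_1(\Omega_X,\Omega_X)$: for every sequence of $\omega$-covers $(\mathcal{U}_n)$ there are $U_n\in\mathcal{U}_n$ with $\{U_n:n\in\mathbb{N}\}$ an $\omega$-cover. $[S]^{\aleph_0}$ denotes the countably infinite subsets of $S$. For $s,T\subseteq A$, $s<T$ means: $a_n\in s$ and $a_m\in T$ imply $n<m$. For $B\subseteq A$ and finite $s\subseteq A$, $B|s=\{a_n\in B: s<\{a_n\}\}$. For finite $s$ and infinite $C\subseteq A$ with $s<C$, $[s,C]=\{s\cup D: D\in[A]^{\aleph_0}, D\subseteq C\}$. For finite $s\subseteq A$ and $B\in[A|s]^{\aleph_0}\cap\Omega_X$: $B$ accepts $s$ if $[s,B]\cap\Omega_X\subseteq R$; $B$ rejects $s$ if no $C\in[B]^{\aleph_0}\cap\Omega_X$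 accepts $s$. -}

module Defs where

open import Data.Nat using (ℕ; _<_; _≤_; _≡ᵇ_; _<ᵇ_)
open import Data.Bool using (Bool; true; false; T; _∨_; _∧_)
open import Data.Product using (Σ; ∃; _×_; _,_)
open import Data.Sum using (_⊎_)
open import Data.Empty using (⊥)
open import Data.Unit using (⊤)
open import Data.List using (List)
open import Data.Bool.ListAction using (any; all)
open import Data.List.Relation.Unary.All using (All)
open import Relation.Nullary using (¬_)
open import Relation.Binary.PropositionalEquality using (_≡_)
open import Function.Bundles using (_⇔_)

Subset : Set → Set₁
Subset A = A → Set

_≐_ : {A : Set} → Subset A → Subset A → Set
U ≐ V = ∀ x → (U x ⇔ V x)

record TopSpace : Set₂ where
  field
    Carrier : Set
    Open    : Subset Carrier → Set
    open-∅  : Open (λ _ → ⊥)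
    open-X  : Open (λ _ → ⊤)
    open-∩  : ∀ U V → Open U → Open V → Open (λ x → U x × V x)
    open-⋃  : (I : Set) (U : I → Subset Carrier) → (∀ i → Open (U i)) →
              Open (λ x → ∃ λ i → U i x)
    open-≐  : ∀ U V → U ≐ V → Open U → Open V

module _ (T : TopSpace) where
  open TopSpace T

  Family : Set₁
  Family = Subset Carrier → Set

  IsOmegaCover : Family → Set₁
  IsOmegaCover 𝓤 =
      (∀ U → 𝓤 U → Open U)
    × (¬ (∃ λ U → 𝓤 U × (∀ x → U x)))
    × (∀ (F : List Carrier) → ∃ λ U → 𝓤 U × All U F)

  S1ΩΩ : Set₁
  S1ΩΩ = (𝓤 : ℕ → Family) → (∀ n → IsOmegaCover (𝓤 n)) →
         ∃ λ (U : ℕ → Subset Carrier) →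
           (∀ n → 𝓤 n (U n)) × IsOmegaCover (λ V → ∃ λ n → V ≐ U n)

-- Subsets of A = {a n : n ∈ ℕ} are represented by their sets of indices
-- (legitimate since the enumeration is bijective): arbitrary subsets as
-- characteristic functions ℕ → Bool, finite subsets as lists of indices.

ISet : Set
ISet = ℕ → Bool

_∈ᵢ_ : ℕ → ISet → Set
n ∈ᵢ S = T (S n)

_⊆ᵢ_ : ISet → ISet → Set
S ⊆ᵢ S' = ∀ n → n ∈ᵢ S → n ∈ᵢ S'

_≗ᵢ_ : ISet → ISet → Set
S ≗ᵢ S' = ∀ n → S n ≡ S' n

Infinite : ISet → Set
Infinite S = ∀ m → ∃ λ n → m ≤ n × n ∈ᵢ S

⌊_⌋ : List ℕ → ISet
⌊ s ⌋ n = any (λ m → n ≡ᵇ m) s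

_∪ᶠ_ : List ℕ → ISet → ISet
(s ∪ᶠ D) n = ⌊ s ⌋ n ∨ D n

_≺_ : List ℕ → ISet → Set
s ≺ S' = ∀ n m → n ∈ᵢ ⌊ s ⌋ → m ∈ᵢ S' → n < m

_∣_ : ISet → List ℕ → ISet
(B ∣ s) n = B n ∧ all (λ m → m <ᵇ n) s

module Ramsey (Tp : TopSpace) (a : ℕ → Subset (TopSpace.Carrier Tp))
              (R : ISet → Set) where

  Ω : ISet → Set₁
  Ω S = IsOmegaCover Tp (λ V → ∃ λ n → n ∈ᵢ S × V ≐ a n)

  InInterval : List ℕ → ISet → ISet → Set
  InInterval s C Y = ∃ λ D → Infinite D × D ⊆ᵢ C × Y ≗ᵢ (s ∪ᶠ D)

  Admissible : List ℕ → ISet → Set₁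
  Admissible s B = s ≺ B × Infinite B × Ω B

  Accepts : List ℕ → ISet → Set₁
  Accepts s B = Admissible s B ×
    (∀ Y → InInterval s B Y → Ω Y → R Y)

  Rejects : List ℕ → ISet → Set₁
  Rejects s B = Admissible s B ×
    (∀ C → C ⊆ᵢ B → Infinite C → Ω C → ¬ Accepts s C)

-- Suppose C is not an ω-cover. As C ⊆ B and the finitely many members of B
-- below t cannot form an ω-cover, the set D = (B|t) ∖ C is an ω-cover, hence
-- infinite. For u ∈ D the set B|(t ∪ {u}) does not reject, so it accepts
-- t ∪ {u}. Every Y = t ∪ E ∈ [t, D] ∩ Ω_X is t ∪ {u} ∪ E|{u} for u = min E, so
-- Y ∈ R: D accepts t, although D ⊆ B|t and B|t rejects t.
module Submission where

open import Defs
open import Level using (0ℓ; Level; lift; lower) renaming (suc to lsuc)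
open import Axiom.ExcludedMiddle using (ExcludedMiddle)
open import Axiom.DoubleNegationElimination using (DoubleNegationElimination; em⇒dne)
open import Data.Nat using (ℕ; zero; suc; _<_; _≤_; _≡ᵇ_; _<ᵇ_; z≤n; _⊔_)
open import Data.Nat.Properties
  using (≤∧≢⇒<; <-irrefl; ≤-<-trans; ≤-trans; m≤n⇒m<n∨m≡n; ≡ᵇ⇒≡; ≡⇒≡ᵇ; <ᵇ⇒<; <⇒<ᵇ;
         m≤m+n; m≤n+m; m≤m⊔n; m≤n⊔m)
open import Data.Nat.ListAction using (sum)
open import Data.Bool using (true; false; T; T?; _∧_; _∨_; not)
open import Data.Bool.Properties using (T-∧)
open import Data.List using (List; []; _∷_; [_]; _++_)
open import Data.List.Membership.Propositional using (_∈_)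
open import Data.List.Relation.Unary.All as All using (All; []; _∷_)
open import Data.List.Relation.Unary.All.Properties using (++⁻ˡ; ++⁻ʳ; all⁺; all⁻)
open import Data.List.Relation.Unary.Any as Any using ()
open import Data.List.Relation.Unary.Any.Properties using (any⁺; any⁻)
open import Data.Product using (_×_; ∃; _,_; proj₁; proj₂)
open import Data.Sum using (_⊎_; inj₁; inj₂; [_,_]′; swap)
open import Data.Empty using (⊥-elim)
open import Data.Unit using (tt)
open import Relation.Nullary using (¬_; yes; no)
open import Relation.Binary.PropositionalEquality using (_≡_; refl; sym; trans; subst)
open import Function.Bundles using (_⇔_; Equivalence)
open import Function.Construct.Identity using (⇔-id)
open import Function.Base using (_∘′_)

dne-lower : {ℓ : Level} → DoubleNegationElimination (lsuc ℓ) → DoubleNegationElimination ℓ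
dne-lower dne ¬¬p = lower (dne λ ¬p↑ → ¬¬p λ p → ¬p↑ (lift p))

∨-∧-regroup : ∀ s d e l → (T d → T e ⊎ T l) → (T e → T d) → (s ∨ d) ≡ ((e ∨ s) ∨ (d ∧ l))
∨-∧-regroup s     false false l _   _   = refl
∨-∧-regroup s     false true  l _   e⇒d = ⊥-elim (e⇒d tt)
∨-∧-regroup false true  true  l _   _   = refl
∨-∧-regroup true  true  true  l _   _   = refl
∨-∧-regroup s     true  false true  _   _   = refl
∨-∧-regroup s     true  false false d⇒e _   with d⇒e tt
... | inj₁ ()
... | inj₂ ()

All-<-sum : ∀ s {n} → sum s < n → All (_< n) s
All-<-sum []      _ = []
All-<-sum (m ∷ s) h = ≤-<-trans (m≤m+n m (sum s)) h ∷ All-<-sum s (≤-<-trans (m≤n+m (sum s) m) h)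

_∖_ : ISet → ISet → ISet
(S ∖ C) n = S n ∧ not (C n)

∈-split : ∀ S C {n} → n ∈ᵢ S → n ∈ᵢ C ⊎ n ∈ᵢ (S ∖ C)
∈-split S C {n} n∈S with C n
... | true  = inj₁ tt
... | false = inj₂ (Equivalence.from T-∧ (n∈S , tt))

∖-⊆ : ∀ S C → (S ∖ C) ⊆ᵢ S
∖-⊆ S C n n∈S∖C = proj₁ (Equivalence.to T-∧ n∈S∖C)

∈-∖⁻ : ∀ S C {n} → n ∈ᵢ (S ∖ C) → ¬ n ∈ᵢ C
∈-∖⁻ S C {n} n∈S∖C with C n
... | false = λ ()
... | true  = λ _ → proj₂ (Equivalence.to (T-∧ {S n}) n∈S∖C)

∈⌊⌋⁺ : ∀ {s n} → n ∈ s → n ∈ᵢ ⌊ s ⌋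
∈⌊⌋⁺ {n = n} n∈s = any⁺ (n ≡ᵇ_) (Any.map (≡⇒≡ᵇ n _) n∈s)

∈⌊⌋⁻ : ∀ s {n} → n ∈ᵢ ⌊ s ⌋ → n ∈ s
∈⌊⌋⁻ s {n} n∈s = Any.map (≡ᵇ⇒≡ n _) (any⁻ (n ≡ᵇ_) s n∈s)

∈-∣⁺ : ∀ S s {n} → n ∈ᵢ S → All (_< n) s → n ∈ᵢ (S ∣ s)
∈-∣⁺ S s n∈S s<n = Equivalence.from T-∧ (n∈S , all⁻ _ (All.map <⇒<ᵇ s<n))

∈-∣⁻ : ∀ S s {n} → n ∈ᵢ (S ∣ s) → n ∈ᵢ S × All (_< n) s
∈-∣⁻ S s {n} n∈S∣s with Equivalence.to (T-∧ {S n}) n∈S∣s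
... | n∈S , s<ᵇn = n∈S , All.map (<ᵇ⇒< _ n) (all⁺ _ s s<ᵇn)

≺-∣ : ∀ S s → s ≺ (S ∣ s)
≺-∣ S s n m n∈s m∈S∣s = All.lookup (proj₂ (∈-∣⁻ S s m∈S∣s)) (∈⌊⌋⁻ s n∈s)

infinite-∣ : ∀ {S} → Infinite S → ∀ s → Infinite (S ∣ s)
infinite-∣ {S} inf s m with inf (suc (sum s) ⊔ m)
... | n , le , n∈S =
  n , ≤-trans (m≤n⊔m (suc (sum s)) m) le ,
  ∈-∣⁺ S s n∈S (All-<-sum s (≤-trans (m≤m⊔n (suc (sum s)) m) le))

Least : ISet → ℕ → Set
Least P u = u ∈ᵢ P × (∀ n → n ∈ᵢ P → u ≤ n)

least-or-lowerBound : ∀ P k → (∀ n → n ∈ᵢ P → k ≤ n) ⊎ ∃ (Least P)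
least-or-lowerBound P zero = inj₁ λ _ _ → z≤n
least-or-lowerBound P (suc k) with least-or-lowerBound P k
... | inj₂ least = inj₂ least
... | inj₁ k≤P with T? (P k)
...   | yes k∈P = inj₂ (k , k∈P , k≤P)
...   | no  k∉P = inj₁ λ n n∈P →
  ≤∧≢⇒< (k≤P n n∈P) λ k≡n → k∉P (subst (_∈ᵢ P) (sym k≡n) n∈P)

∃-least : ∀ P {w} → w ∈ᵢ P → ∃ (Least P)
∃-least P {w} w∈P with least-or-lowerBound P (suc w)
... | inj₁ w<P  = ⊥-elim (<-irrefl refl (w<P w w∈P))
... | inj₂ least = least

∪ᶠ-least : ∀ s D {u} → Least D u → (s ∪ᶠ D) ≗ᵢ ((u ∷ s) ∪ᶠ (D ∣ [ u ]))
∪ᶠ-least s D {u} (u∈D , u≤D) n =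
  ∨-∧-regroup (⌊ s ⌋ n) (D n) (n ≡ᵇ u) ((u <ᵇ n) ∧ true) at-or-above at-u
  where
  at-or-above : n ∈ᵢ D → T (n ≡ᵇ u) ⊎ T ((u <ᵇ n) ∧ true)
  at-or-above n∈D with m≤n⇒m<n∨m≡n (u≤D n n∈D)
  ... | inj₁ u<n = inj₂ (Equivalence.from T-∧ (<⇒<ᵇ u<n , tt))
  ... | inj₂ u≡n = inj₁ (≡⇒≡ᵇ n u (sym u≡n))
  at-u : T (n ≡ᵇ u) → n ∈ᵢ D
  at-u n≡u = subst (_∈ᵢ D) (sym (≡ᵇ⇒≡ n u n≡u)) u∈D

module Covering (Tp : TopSpace) (a : ℕ → Subset (TopSpace.Carrier Tp)) where
  open TopSpace Tp

  Covers : ISet → Set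
  Covers S = ∀ (F : List Carrier) → ∃ λ n → n ∈ᵢ S × All (a n) F

  Proper : ISet → Set
  Proper S = ∀ n → n ∈ᵢ S → ¬ (∀ x → a n x)

  proper-⊆ : ∀ {S S'} → S' ⊆ᵢ S → Proper S → Proper S'
  proper-⊆ S'⊆S proper n n∈S' = proper n (S'⊆S n n∈S')

  module _ (dne : DoubleNegationElimination 0ℓ) where

    outside-point : ∀ {U : Subset Carrier} → ¬ (∀ x → U x) → ∃ λ x → ¬ U x
    outside-point ¬total = dne λ ¬∃ → ¬total λ x → dne λ ¬Ux → ¬∃ (x , ¬Ux)

    -- One point outside each proper member below m.
    avoiding-list : ∀ {S} → Proper S → ∀ m → ∃ λ F → ∀ n → n ∈ᵢ S → All (a n) F → m ≤ n
    avoiding-list proper zero = [] , λ _ _ _ → z≤n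
    avoiding-list {S} proper (suc m) with avoiding-list proper m | T? (S m)
    ... | F , m≤ | no m∉S = F , λ n n∈S F⊆an →
      ≤∧≢⇒< (m≤ n n∈S F⊆an) λ m≡n → m∉S (subst (_∈ᵢ S) (sym m≡n) n∈S)
    ... | F , m≤ | yes m∈S with outside-point (proper m m∈S)
    ...   | x , x∉am = x ∷ F , λ { n n∈S (x∈an ∷ F⊆an) →
      ≤∧≢⇒< (m≤ n n∈S F⊆an) λ m≡n → x∉am (subst (λ k → a k x) (sym m≡n) x∈an) }

    covers⇒infinite : ∀ {S} → Covers S → Proper S → Infinite S
    covers⇒infinite cov proper m with avoiding-list proper m
    ... | F , m≤ with cov F
    ...   | n , n∈S , F⊆an = n , m≤ n n∈S F⊆an , n∈S

    covers-split : ∀ {S P Q} → Covers S → (∀ n → n ∈ᵢ S → n ∈ᵢ P ⊎ n ∈ᵢ Q) →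
                   ¬ Covers P → Covers Q
    covers-split covS split ¬covP F = dne λ ¬QF → ¬covP λ F₁ → dne λ ¬PF₁ →
      let n , n∈S , F₁F⊆an = covS (F₁ ++ F) in
      [ (λ n∈P → ¬PF₁ (n , n∈P , ++⁻ˡ F₁ F₁F⊆an)) ,
        (λ n∈Q → ¬QF (n , n∈Q , ++⁻ʳ F₁ F₁F⊆an)) ]′ (split n n∈S)

    -- The members of S not above t are at most sum t, so they do not cover.
    covers-∣ : ∀ {S} → Covers S → Proper S → ∀ t → Covers (S ∣ t)
    covers-∣ {S} cov proper t =
      covers-split cov (λ n n∈S → swap (∈-split S (S ∣ t) n∈S)) ¬covers-rest
      where
      rest : ISet
      rest = S ∖ (S ∣ t)
      ¬covers-rest : ¬ Covers rest
      ¬covers-rest cov-rest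
        with covers⇒infinite cov-rest (proper-⊆ (∖-⊆ S (S ∣ t)) proper) (suc (sum t))
      ... | n , sum<n , n∈rest =
        ∈-∖⁻ S (S ∣ t) n∈rest (∈-∣⁺ S t (∖-⊆ S (S ∣ t) n n∈rest) (All-<-sum t sum<n))

module _ (Tp : TopSpace) (a : ℕ → Subset (TopSpace.Carrier Tp)) (R : ISet → Set) where
  open Ramsey Tp a R
  open Covering Tp a

  Ω⇒covers : ∀ {S} → Ω S → Covers S
  Ω⇒covers (_ , _ , cov) F with cov F
  ... | U , (n , n∈S , U≐an) , F⊆U = n , n∈S , All.map (λ {x} → Equivalence.to (U≐an x)) F⊆U

  Ω⇒proper : ∀ {S} → Ω S → Proper S
  Ω⇒proper (_ , ¬total , _) n n∈S total = ¬total (a n , (n , n∈S , λ x → ⇔-id (a n x)) , total)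

  Ω-⊆ : ∀ {S S'} → Ω S → S' ⊆ᵢ S → Covers S' → Ω S'
  Ω-⊆ (isOpen , ¬total , _) S'⊆S cov =
    (λ { U (n , n∈S' , U≐an) → isOpen U (n , S'⊆S n n∈S' , U≐an) }) ,
    (λ { (U , (n , n∈S' , U≐an) , total) → ¬total (U , (n , S'⊆S n n∈S' , U≐an) , total) }) ,
    λ F → let n , n∈S' , F⊆an = cov F in a n , (n , n∈S' , λ x → ⇔-id (a n x)) , F⊆an

  interval-in-R : ∀ t B D → D ⊆ᵢ (B ∣ t) →
                  (∀ u → u ∈ᵢ D → Accepts (u ∷ t) (B ∣ (u ∷ t))) →
                  ∀ Y → InInterval t D Y → Ω Y → R Y
  interval-in-R t B D D⊆B∣t accepts Y (E , infE , E⊆D , Y≗t∪E) ΩY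
    with ∃-least E (proj₂ (proj₂ (infE 0)))
  ... | u , least@(u∈E , _) =
    proj₂ (accepts u (E⊆D u u∈E)) Y (E ∣ [ u ] , infinite-∣ infE [ u ] , E∣u⊆ , Y≗) ΩY
    where
    E∣u⊆ : (E ∣ [ u ]) ⊆ᵢ (B ∣ (u ∷ t))
    E∣u⊆ n n∈E∣u with ∈-∣⁻ E [ u ] n∈E∣u
    ... | n∈E , u<n ∷ [] with ∈-∣⁻ B t (D⊆B∣t n (E⊆D n n∈E))
    ...   | n∈B , t<n = ∈-∣⁺ B (u ∷ t) n∈B (u<n ∷ t<n)
    Y≗ : Y ≗ᵢ ((u ∷ t) ∪ᶠ (E ∣ [ u ]))
    Y≗ n = trans (Y≗t∪E n) (∪ᶠ-least t E least n)

  ¬¬Ω-of-rejecting : DoubleNegationElimination 0ℓ → ∀ t B C → Ω B → Rejects t (B ∣ t) →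
                     C ⊆ᵢ B → (∀ u → u ∈ᵢ B → ¬ u ∈ᵢ C → Accepts (u ∷ t) (B ∣ (u ∷ t))) →
                     ¬ ¬ Ω C
  ¬¬Ω-of-rejecting dne t B C ΩB (_ , rejects) C⊆B accepts ¬ΩC =
    rejects D D⊆B∣t infD ΩD ((t≺D , infD , ΩD) , interval-in-R t B D D⊆B∣t acceptsD)
    where
    D : ISet
    D = (B ∣ t) ∖ C
    D⊆B∣t : D ⊆ᵢ (B ∣ t)
    D⊆B∣t = ∖-⊆ (B ∣ t) C
    D⊆B : D ⊆ᵢ B
    D⊆B n n∈D = proj₁ (∈-∣⁻ B t (D⊆B∣t n n∈D))
    coversD : Covers D
    coversD =
      covers-split dne (covers-∣ dne (Ω⇒covers ΩB) (Ω⇒proper ΩB) t)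
        (λ _ → ∈-split (B ∣ t) C) λ coversC → ¬ΩC (Ω-⊆ ΩB C⊆B coversC)
    ΩD : Ω D
    ΩD = Ω-⊆ ΩB D⊆B coversD
    infD : Infinite D
    infD = covers⇒infinite dne coversD (Ω⇒proper ΩD)
    t≺D : t ≺ D
    t≺D n m n∈t m∈D = ≺-∣ B t n m n∈t (D⊆B∣t m m∈D)
    acceptsD : ∀ u → u ∈ᵢ D → Accepts (u ∷ t) (B ∣ (u ∷ t))
    acceptsD u u∈D = accepts u (D⊆B u u∈D) (∈-∖⁻ (B ∣ t) C u∈D)

lemma3 : ExcludedMiddle (lsuc 0ℓ) →
    (Tp : TopSpace) → S1ΩΩ Tp →
    (a : ℕ → Subset (TopSpace.Carrier Tp)) →
    (∀ n m → a n ≐ a m → n ≡ m) →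
    IsOmegaCover Tp (λ V → ∃ λ n → V ≐ a n) →
    (R : ISet → Set) →
    (∀ Y Z → Y ≗ᵢ Z → R Y → R Z) →
    (∀ Y → R Y → Infinite Y × Ramsey.Ω Tp a R Y) →
    (t : List ℕ) →
    (B : ISet) → Infinite B → Ramsey.Ω Tp a R B →
    (∀ (s : List ℕ) → All (λ n → n ∈ᵢ ⌊ t ⌋ ⊎ n ∈ᵢ B) s →
    Ramsey.Accepts Tp a R s (B ∣ s) ⊎ Ramsey.Rejects Tp a R s (B ∣ s)) →
    Ramsey.Rejects Tp a R t (B ∣ t) →
    (C : ISet) →
    (∀ u → T (C u) ⇔ (u ∈ᵢ B × Ramsey.Rejects Tp a R (u ∷ t) (B ∣ (u ∷ t)))) →
    Ramsey.Ω Tp a R C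
lemma3 em Tp _ a _ _ R _ _ t B _ ΩB dichotomy rejects C C≡rejecting =
  em⇒dne em (¬¬Ω-of-rejecting Tp a R (dne-lower (em⇒dne em)) t B C ΩB rejects C⊆B accepts)
  where
  C⊆B : C ⊆ᵢ B
  C⊆B u u∈C = proj₁ (Equivalence.to (C≡rejecting u) u∈C)
  accepts : ∀ u → u ∈ᵢ B → ¬ u ∈ᵢ C → Ramsey.Accepts Tp a R (u ∷ t) (B ∣ (u ∷ t))
  accepts u u∈B u∉C with dichotomy (u ∷ t) (inj₂ u∈B ∷ All.tabulate (inj₁ ∘′ ∈⌊⌋⁺))
  ... | inj₁ acc = acc
  ... | inj₂ rej = ⊥-elim (u∉C (Equivalence.from (C≡rejecting u) (u∈B , rej)))
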